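{- Let $s,t\in\mathbb{N}$ and let $\boldsymbol{\alpha}=(\alpha_1,\ldots,\alpha_s)\in\mathbb{D}^s$, $\boldsymbol{\beta}=(\beta_1,\ldots,\beta_t)\in\mathbb{D}^t$. Then in $\mathscr{A}$, \[ \left(\mathfrak{L}_p\big(\mathrm{Li}(\boldsymbol{\alpha};z)\,\mathrm{Li}(\boldsymbol{\beta};z)\big)\bmod p \right)_p =\mathrm{sgn}(\boldsymbol{\beta})\,(-1)^{|\boldsymbol{\beta}|}\,\zeta_{\mathscr{A}}(\alpha_1,\ldots,\alpha_s,\beta_t,\ldots,\beta_1), \] where $\mathrm{sgn}(\boldsymbol{\beta}):=\prod_{i=1}^t\mathrm{sgn}(\beta_i)$ and $|\boldsymbol{\beta}|=\sum_i|\beta_i|$.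
   Context: $\mathscr{A}:=\left(\prod_{p \text{ prime}}\mathbb{Z}/p\mathbb{Z}\right)\big/\left(\bigoplus_{p\text{ prime}}\mathbb{Z}/p\mathbb{Z}\right)$. $\mathbb{N}=\{1,2,\dots\}$, $\mathbb{D}:=\mathbb{Z}\setminus\{0\}$; for $a\in\mathbb{D}$, $\mathrm{sgn}(a)\in\{\pm1\}$ is its sign and $|a|$ its absolute value. For $\boldsymbol{\alpha}\in\mathbb{D}^r$, $\mathrm{Li}(\boldsymbol{\alpha};z):=\sum_{0<m_1<\cdots<m_r}\frac{\mathrm{sgn}(\alpha_1)^{m_1}\cdots\mathrm{sgn}(\alpha_r)^{m_r}}{m_1^{|\alpha_1|}\cdots m_r^{|\alpha_r|}}z^{m_r}$, regarded as a formal power series in $\mathbb{Q}[[z]]$; the product is the product of formal power series. For a prime $p$, $\mathfrak{L}_p:\mathbb{Q}[[z]]\to\mathbb{Q}$ is the $\mathbb{Q}$-linear map $\mathfrak{L}_p(\sum_{n\ge0}a_nz^n)=\sum_{n=0}^{p-1}a_n$ (the resulting rationals have denominators prime to $p$, so reduction mod $p$ makes sense). The finite alternating multiple zeta value is $\zeta_{\mathscr{A}}(\alpha_1,\dots,\alpha_r):=\left(\sum_{0<m_1<\cdots<m_r<p}\frac{\mathrm{sgn}(\alpha_1)^{m_1}\cdots\mathrm{sgn}(\alpha_r)^{m_r}}{m_1^{|\alpha_1|}\cdots m_r^{|\alpha_r|}} \bmod p\right)_p\in\mathscr{A}$. -}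

module Defs where

open import Data.Nat as ℕ using (ℕ; zero; suc; _∸_; _<_)
open import Data.Nat.Divisibility using (_∣_)
open import Data.Nat.Primality using (Prime)
open import Data.Product using (Σ)
open import Data.Nat.Properties using (m^n≢0)
open import Data.Integer as ℤ using (ℤ; +_; -[1+_])
open import Data.Rational as ℚ using (ℚ; 0ℚ; 1ℚ; ↥_; _+_; _*_; _-_; -_)
open import Data.List using (List; []; _∷_; reverse)

Σ< : ℕ → (ℕ → ℚ) → ℚ
Σ< zero    f = 0ℚ
Σ< (suc N) f = Σ< N f + f N

_^ℚ_ : ℚ → ℕ → ℚ
q ^ℚ zero  = 1ℚ
q ^ℚ suc n = q * (q ^ℚ n)

sgn : ℤ → ℚ
sgn -[1+ _ ] = - 1ℚ
sgn (+ _)    = 1ℚ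

-- the summand sgn(a)^m / m^|a|  (only used for m ≥ 1)
term : ℤ → ℕ → ℚ
term a zero    = 0ℚ
term a (suc m) = (sgn a ^ℚ suc m) * (ℚ._/_ (+ 1) (suc m ℕ.^ ℤ.∣ a ∣) {{m^n≢0 (suc m) ℤ.∣ a ∣}})

-- Given the index list in REVERSED order (a_r, ..., a_1),
-- hsRev (a_r ∷ ... ∷ a_1 ∷ []) N
--   = Σ_{0<m_1<...<m_r<N} Π_i sgn(a_i)^{m_i} / m_i^{|a_i|}
hsRev : List ℤ → ℕ → ℚ
hsRev []       N = 1ℚ
hsRev (a ∷ as) N = Σ< N (λ m → term a m * hsRev as m)

rev : List ℤ → List ℤ
rev = reverse

H : List ℤ → ℕ → ℚ
H α N = hsRev (rev α) N

-- coefficient of z^n in Li(α; z) = Σ_{0<m_1<...<m_r} (...) z^{m_r}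
-- i.e. the sum over 0<m_1<...<m_{r-1}<m_r = n.
liCoeffRev : List ℤ → ℕ → ℚ
liCoeffRev []       zero    = 1ℚ
liCoeffRev []       (suc n) = 0ℚ
liCoeffRev (a ∷ as) n       = term a n * hsRev as n

LiCoeff : List ℤ → ℕ → ℚ
LiCoeff α n = liCoeffRev (rev α) n

prodCoeff : (ℕ → ℚ) → (ℕ → ℚ) → ℕ → ℚ
prodCoeff f g n = Σ< (suc n) (λ k → f k * g (n ∸ k))

𝔏 : ℕ → (ℕ → ℚ) → ℚ
𝔏 p f = Σ< p f

-- congruence of rationals modulo p: p divides the (reduced) numerator of x - y
-- (meaningful when the denominators of x, y are prime to p)
_≡_[modℚ_] : ℚ → ℚ → ℕ → Set
x ≡ y [modℚ p ] = p ∣ ℤ.∣ (↥ (x - y)) ∣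

-- equality in 𝒜 = Π_p 𝔽_p / ⊕_p 𝔽_p of the elements (x p mod p)_p and (y p mod p)_p:
-- they agree for all but finitely many primes.
_≡𝒜_ : (ℕ → ℚ) → (ℕ → ℚ) → Set
x ≡𝒜 y = Σ ℕ (λ N → (p : ℕ) → Prime p → N < p → x p ≡ y p [modℚ p ])

sgnList : List ℤ → ℚ
sgnList []       = 1ℚ
sgnList (b ∷ bs) = sgn b * sgnList bs

wt : List ℤ → ℕ
wt []       = 0
wt (b ∷ bs) = ℤ.∣ b ∣ ℕ.+ wt bs

-- Expanding the product, 𝔏_p(Li(α) Li(β)) = Σ_{k<p} A_k H_β(p − k), where A_k is the
-- coefficient of z^k in Li(α) and H_β(N) the harmonic sum of β truncated at N. The
-- substitution n ↦ p − n turns H_β(p − k) into a sum over k < n_t < ⋯ < n_1 < p, and since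
-- p − n ≡ −n (mod p), each factor sgn(b)^{p−n} / (p−n)^{|b|} is congruent to
-- sgn(b) (−1)^{|b|} sgn(b)^n / n^{|b|}, p being odd. So H_β(p − k) is congruent to
-- sgn(β) (−1)^{|β|} times the tail of the harmonic sum of (β_t, …, β_1) above k, and summing
-- A_k against these tails is the harmonic sum of (α_1, …, α_s, β_t, …, β_1) split at α_s.
module Submission where

open import Defs
open import Data.Nat using (ℕ; _≤_)
open import Data.Integer using (ℤ; 0ℤ)
open import Data.Rational using (_*_; -_; 1ℚ)
open import Data.Vec using (Vec; toList)
open import Data.Vec.Relation.Unary.All using (All)
open import Data.List using (_++_; reverse)
open import Relation.Binary.PropositionalEquality using (_≢_)

open import Data.Nat as ℕ using (zero; suc; _∸_; _<_; _≤′_; ≤′-reflexive; ≤′-step; z≤n; s≤s; _<?_)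
import Data.Nat.Properties as ℕP
open import Data.Nat.Divisibility as ℕ∣ using (divides; ∣1⇒≡1) renaming (_∣_ to _∣ℕ_)
open import Data.Nat.Primality using (Prime; euclidsLemma; ¬prime[1]; prime⇒irreducible)
open import Data.Nat.Coprimality using (coprime?)
open import Data.Integer as ℤ using (+_; -[1+_]; -1ℤ)
import Data.Integer.Properties as ℤP
open import Data.Integer.Divisibility.Signed as ℤ∣ using (_∣_)
import Data.Integer.Tactic.RingSolver as ℤ-Solver
open import Data.Rational as ℚ using (ℚ; mkℚ; 0ℚ; _+_; _-_; ↥_; ↧ₙ_; toℚᵘ)
import Data.Rational.Properties as ℚP
open import Data.Rational.Unnormalised as ℚᵘ using (ℚᵘ; mkℚᵘ; *≡*; _≃_)
import Data.Rational.Unnormalised.Properties as ℚᵘP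
open import Data.Vec using (_∷_)
open import Data.List using (List; []; _∷_; _∷ʳ_; [_]; initLast; _∷ʳ′_)
open import Data.List.Properties using (unfold-reverse; reverse-++; reverse-involutive; ∷ʳ-++)
open import Data.Maybe.Base using (Maybe; just; nothing)
open import Data.Product using (Σ; _,_)
open import Data.Sum using (_⊎_; inj₁; inj₂)
open import Function using (_⇔_; mk⇔; Equivalence)
open import Level using (0ℓ)
open import Relation.Binary.PropositionalEquality
  using (_≡_; refl; sym; trans; cong; cong₂; subst; subst₂; module ≡-Reasoning)
open import Relation.Nullary using (yes; no; ¬_)
open import Relation.Nullary.Decidable using (recompute)
open import Relation.Nullary.Negation using (contradiction)
open import Tactic.RingSolver using (solve-∀)
import Tactic.RingSolver.Core.AlmostCommutativeRing as ACR

open ≡-Reasoning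

ℚ-ring : ACR.AlmostCommutativeRing 0ℓ 0ℓ
ℚ-ring = ACR.fromCommutativeRing ℚP.+-*-commutativeRing is-zero?
  where
  is-zero? : (x : ℚ) → Maybe (0ℚ ≡ x)
  is-zero? x with 0ℚ ℚP.≟ x
  ... | yes e = just e
  ... | no _  = nothing

Σ<-cong : ∀ N {f g : ℕ → ℚ} → (∀ k → k < N → f k ≡ g k) → Σ< N f ≡ Σ< N g
Σ<-cong zero    f≗g = refl
Σ<-cong (suc N) f≗g =
  cong₂ _+_ (Σ<-cong N (λ k k<N → f≗g k (ℕP.m<n⇒m<1+n k<N))) (f≗g N (ℕP.n<1+n N))

Σ<-+ : ∀ N (f g : ℕ → ℚ) → Σ< N (λ k → f k + g k) ≡ Σ< N f + Σ< N g
Σ<-+ zero    f g = refl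
Σ<-+ (suc N) f g = begin
  Σ< N (λ k → f k + g k) + (f N + g N)  ≡⟨ cong (_+ (f N + g N)) (Σ<-+ N f g) ⟩
  (Σ< N f + Σ< N g) + (f N + g N)       ≡⟨ interchange (Σ< N f) (Σ< N g) (f N) (g N) ⟩
  (Σ< N f + f N) + (Σ< N g + g N)       ∎
  where
  interchange : ∀ a b c d → (a + b) + (c + d) ≡ (a + c) + (b + d)
  interchange = solve-∀ ℚ-ring

Σ<-*ˡ : ∀ N c (f : ℕ → ℚ) → Σ< N (λ k → c * f k) ≡ c * Σ< N f
Σ<-*ˡ zero    c f = sym (ℚP.*-zeroʳ c)
Σ<-*ˡ (suc N) c f = begin
  Σ< N (λ k → c * f k) + c * f N  ≡⟨ cong (_+ c * f N) (Σ<-*ˡ N c f) ⟩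
  c * Σ< N f + c * f N            ≡⟨ ℚP.*-distribˡ-+ c (Σ< N f) (f N) ⟨
  c * (Σ< N f + f N)              ∎

Σ<-shift : ∀ N (f : ℕ → ℚ) → Σ< (suc N) f ≡ f 0 + Σ< N (λ k → f (suc k))
Σ<-shift zero    f = trans (ℚP.+-identityˡ (f 0)) (sym (ℚP.+-identityʳ (f 0)))
Σ<-shift (suc N) f = begin
  Σ< (suc N) f + f (suc N)                       ≡⟨ cong (_+ f (suc N)) (Σ<-shift N f) ⟩
  (f 0 + Σ< N (λ k → f (suc k))) + f (suc N)     ≡⟨ ℚP.+-assoc (f 0) _ (f (suc N)) ⟩
  f 0 + Σ< (suc N) (λ k → f (suc k))             ∎

Σ<-reverse : ∀ N (f : ℕ → ℚ) → Σ< N f ≡ Σ< N (λ j → f (N ∸ suc j))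
Σ<-reverse zero    f = refl
Σ<-reverse (suc N) f = begin
  Σ< N f + f N                        ≡⟨ cong (_+ f N) (Σ<-reverse N f) ⟩
  Σ< N (λ j → f (N ∸ suc j)) + f N    ≡⟨ ℚP.+-comm _ (f N) ⟩
  f N + Σ< N (λ j → f (N ∸ suc j))    ≡⟨ Σ<-shift N (λ j → f (N ∸ j)) ⟨
  Σ< (suc N) (λ j → f (N ∸ j))        ∎

Σ<-convolution : ∀ N (A B : ℕ → ℚ) →
  Σ< N (λ n → Σ< (suc n) (λ k → A k * B (n ∸ k))) ≡ Σ< N (λ k → A k * Σ< (N ∸ k) B)
Σ<-convolution zero    A B = refl
Σ<-convolution (suc N) A B = begin
  Σ< N (λ n → Σ< (suc n) (λ k → A k * B (n ∸ k))) + (Σ< N (λ k → A k * B (N ∸ k)) + A N * B (N ∸ N))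
    ≡⟨ cong₂ (λ x m → x + (Σ< N (λ k → A k * B (N ∸ k)) + A N * B m)) (Σ<-convolution N A B) (ℕP.n∸n≡0 N) ⟩
  Σ< N (λ k → A k * Σ< (N ∸ k) B) + (Σ< N (λ k → A k * B (N ∸ k)) + A N * B 0)
    ≡⟨ regroup (Σ< N (λ k → A k * Σ< (N ∸ k) B)) (Σ< N (λ k → A k * B (N ∸ k))) (A N) (B 0) ⟩
  (Σ< N (λ k → A k * Σ< (N ∸ k) B) + Σ< N (λ k → A k * B (N ∸ k))) + A N * Σ< 1 B
    ≡⟨ cong (_+ A N * Σ< 1 B) (Σ<-+ N _ _) ⟨
  Σ< N (λ k → A k * Σ< (N ∸ k) B + A k * B (N ∸ k)) + A N * Σ< 1 B
    ≡⟨ cong₂ _+_ (Σ<-cong N grow) (cong (λ m → A N * Σ< m B) (ℕP.m+n∸n≡m 1 N)) ⟨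
  Σ< N (λ k → A k * Σ< (suc N ∸ k) B) + A N * Σ< (suc N ∸ N) B
    ∎
  where
  regroup : ∀ x y a b → x + (y + a * b) ≡ (x + y) + a * (0ℚ + b)
  regroup = solve-∀ ℚ-ring
  grow : ∀ k → k < N → A k * Σ< (suc N ∸ k) B ≡ A k * Σ< (N ∸ k) B + A k * B (N ∸ k)
  grow k k<N = begin
    A k * Σ< (suc N ∸ k) B          ≡⟨ cong (λ m → A k * Σ< m B) (ℕP.+-∸-assoc 1 (ℕP.<⇒≤ k<N)) ⟩
    A k * (Σ< (N ∸ k) B + B (N ∸ k)) ≡⟨ ℚP.*-distribˡ-+ (A k) _ _ ⟩
    A k * Σ< (N ∸ k) B + A k * B (N ∸ k) ∎

infixr 8 𝟙[_<_]_

𝟙[_<_]_ : ℕ → ℕ → ℚ → ℚ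
𝟙[ a < b ] x with a <? b
... | yes _ = x
... | no  _ = 0ℚ

𝟙-holds : ∀ {a b} x → a < b → 𝟙[ a < b ] x ≡ x
𝟙-holds {a} {b} x a<b with a <? b
... | yes _   = refl
... | no  a≮b = contradiction a<b a≮b

𝟙-fails : ∀ {a b} x → ¬ a < b → 𝟙[ a < b ] x ≡ 0ℚ
𝟙-fails {a} {b} x a≮b with a <? b
... | yes a<b = contradiction a<b a≮b
... | no  _   = refl

𝟙-⇔ : ∀ {a b c d} x → (a < b ⇔ c < d) → 𝟙[ a < b ] x ≡ 𝟙[ c < d ] x
𝟙-⇔ {a} {b} {c} {d} x a<b⇔c<d with a <? b | c <? d
... | yes _   | yes _   = refl
... | no  _   | no  _   = refl
... | yes a<b | no  c≮d = contradiction (Equivalence.to a<b⇔c<d a<b) c≮d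
... | no  a≮b | yes c<d = contradiction (Equivalence.from a<b⇔c<d c<d) a≮b

𝟙-comm : ∀ a b c d x → 𝟙[ a < b ] 𝟙[ c < d ] x ≡ 𝟙[ c < d ] 𝟙[ a < b ] x
𝟙-comm a b c d x with a <? b | c <? d
... | yes _ | yes _ = refl
... | yes _ | no  _ = refl
... | no  _ | yes _ = refl
... | no  _ | no  _ = refl

𝟙-0 : ∀ a b → 𝟙[ a < b ] 0ℚ ≡ 0ℚ
𝟙-0 a b with a <? b
... | yes _ = refl
... | no  _ = refl

𝟙-+ : ∀ a b x y → 𝟙[ a < b ] (x + y) ≡ 𝟙[ a < b ] x + 𝟙[ a < b ] y
𝟙-+ a b x y with a <? b
... | yes _ = refl
... | no  _ = refl

𝟙-*ˡ : ∀ a b c x → 𝟙[ a < b ] (c * x) ≡ c * 𝟙[ a < b ] x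
𝟙-*ˡ a b c x with a <? b
... | yes _ = refl
... | no  _ = sym (ℚP.*-zeroʳ c)

Σ⟨_⋯_⟩_ : ℕ → ℕ → (ℕ → ℚ) → ℚ
Σ⟨ lo ⋯ hi ⟩ f = Σ< hi (λ n → 𝟙[ lo < n ] f n)

Σ⟨⟩-cong : ∀ lo hi {f g : ℕ → ℚ} → (∀ n → lo < n → n < hi → f n ≡ g n) →
  Σ⟨ lo ⋯ hi ⟩ f ≡ Σ⟨ lo ⋯ hi ⟩ g
Σ⟨⟩-cong lo hi {f} {g} f≗g = Σ<-cong hi pointwise
  where
  pointwise : ∀ n → n < hi → 𝟙[ lo < n ] f n ≡ 𝟙[ lo < n ] g n
  pointwise n n<hi with lo <? n
  ... | yes lo<n = f≗g n lo<n n<hi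
  ... | no  _    = refl

Σ⟨⟩-+ : ∀ lo hi (f g : ℕ → ℚ) → Σ⟨ lo ⋯ hi ⟩ (λ n → f n + g n) ≡ Σ⟨ lo ⋯ hi ⟩ f + Σ⟨ lo ⋯ hi ⟩ g
Σ⟨⟩-+ lo hi f g = trans (Σ<-cong hi (λ n _ → 𝟙-+ lo n (f n) (g n))) (Σ<-+ hi _ _)

Σ⟨⟩-*ˡ : ∀ lo hi c (f : ℕ → ℚ) → Σ⟨ lo ⋯ hi ⟩ (λ n → c * f n) ≡ c * Σ⟨ lo ⋯ hi ⟩ f
Σ⟨⟩-*ˡ lo hi c f = trans (Σ<-cong hi (λ n _ → 𝟙-*ˡ lo n c (f n))) (Σ<-*ˡ hi c _)

Σ⟨⟩-from-0 : ∀ N (f : ℕ → ℚ) → f 0 ≡ 0ℚ → Σ⟨ 0 ⋯ N ⟩ f ≡ Σ< N f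
Σ⟨⟩-from-0 N f f0≡0 = Σ<-cong N pointwise
  where
  pointwise : ∀ n → n < N → 𝟙[ 0 < n ] f n ≡ f n
  pointwise zero    _ = trans (𝟙-fails {0} {0} (f 0) (λ ())) (sym f0≡0)
  pointwise (suc n) _ = 𝟙-holds (f (suc n)) (s≤s (z≤n {n}))

Σ⟨⟩-empty : ∀ lo hi (f : ℕ → ℚ) → hi ≤ suc lo → Σ⟨ lo ⋯ hi ⟩ f ≡ 0ℚ
Σ⟨⟩-empty lo zero    f _        = refl
Σ⟨⟩-empty lo (suc hi) f hi≤lo+1 = begin
  Σ⟨ lo ⋯ hi ⟩ f + 𝟙[ lo < hi ] f hi ≡⟨ cong₂ _+_ (Σ⟨⟩-empty lo hi f (ℕP.m≤n⇒m≤1+n (ℕP.≤-pred hi≤lo+1)))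
                                                 (𝟙-fails (f hi) (ℕP.≤⇒≯ (ℕP.≤-pred hi≤lo+1))) ⟩
  0ℚ + 0ℚ                            ≡⟨⟩
  0ℚ                                 ∎

𝟙-Σ⟨⟩ : ∀ lo hi (f : ℕ → ℚ) → 𝟙[ lo < hi ] Σ⟨ lo ⋯ hi ⟩ f ≡ Σ⟨ lo ⋯ hi ⟩ f
𝟙-Σ⟨⟩ lo hi f with lo <? hi
... | yes _   = refl
... | no  lo≮hi = sym (Σ⟨⟩-empty lo hi f (ℕP.m≤n⇒m≤1+n (ℕP.≮⇒≥ lo≮hi)))

Σ⟨⟩-swap : ∀ lo hi (F : ℕ → ℕ → ℚ) →
  Σ⟨ lo ⋯ hi ⟩ (λ k → Σ⟨ k ⋯ hi ⟩ (F k)) ≡ Σ⟨ lo ⋯ hi ⟩ (λ n → Σ⟨ lo ⋯ n ⟩ (λ k → F k n))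
Σ⟨⟩-swap lo zero     F = refl
Σ⟨⟩-swap lo (suc hi) F = begin
  Σ⟨ lo ⋯ hi ⟩ (λ k → Σ⟨ k ⋯ suc hi ⟩ (F k)) + 𝟙[ lo < hi ] Σ⟨ hi ⋯ suc hi ⟩ (F hi)
    ≡⟨ cong₂ _+_ (Σ⟨⟩-cong lo hi (λ k _ k<hi → cong (λ x → Σ⟨ k ⋯ hi ⟩ (F k) + x) (𝟙-holds (F k hi) k<hi)))
                 (trans (cong 𝟙[ lo < hi ]_ (Σ⟨⟩-empty hi (suc hi) (F hi) ℕP.≤-refl)) (𝟙-0 lo hi)) ⟩
  Σ⟨ lo ⋯ hi ⟩ (λ k → Σ⟨ k ⋯ hi ⟩ (F k) + F k hi) + 0ℚ
    ≡⟨ ℚP.+-identityʳ _ ⟩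
  Σ⟨ lo ⋯ hi ⟩ (λ k → Σ⟨ k ⋯ hi ⟩ (F k) + F k hi)
    ≡⟨ Σ⟨⟩-+ lo hi _ _ ⟩
  Σ⟨ lo ⋯ hi ⟩ (λ k → Σ⟨ k ⋯ hi ⟩ (F k)) + Σ⟨ lo ⋯ hi ⟩ (λ k → F k hi)
    ≡⟨ cong₂ _+_ (Σ⟨⟩-swap lo hi F) (sym (𝟙-Σ⟨⟩ lo hi (λ k → F k hi))) ⟩
  Σ⟨ lo ⋯ hi ⟩ (λ n → Σ⟨ lo ⋯ n ⟩ (λ k → F k n)) + 𝟙[ lo < hi ] Σ⟨ lo ⋯ hi ⟩ (λ k → F k hi)
    ∎

<-∸-swap : ∀ {m n o} → m < o ∸ n → n < o ∸ m
<-∸-swap {m} {n} {o} m<o∸n = ℕP.m+n≤o⇒m≤o∸n (suc n) (subst (_≤ o) (cong suc (ℕP.+-comm m n)) m+n<o)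
  where
  n<o : n < o
  n<o = ℕP.m∸n≢0⇒n<m (ℕP.m>n⇒m∸n≢0 (ℕP.≤-trans (s≤s z≤n) m<o∸n))
  m+n<o : suc m ℕ.+ n ≤ o
  m+n<o = ℕP.m≤o∸n⇒m+n≤o (suc m) (ℕP.<⇒≤ n<o) m<o∸n

∸-<-swap : ∀ {m n o} → m ≤ o → n ≤ o → o ∸ m < n → o ∸ n < m
∸-<-swap {m} {n} {o} m≤o n≤o o∸m<n = ℕP.+-cancelʳ-< n (o ∸ n) m
  (subst₂ _<_ (trans (ℕP.m∸n+n≡m m≤o) (sym (ℕP.m∸n+n≡m n≤o))) (ℕP.+-comm n m) (ℕP.+-monoˡ-< m o∸m<n))

Σ⟨⟩-pad : ∀ lo hi {M} (f : ℕ → ℚ) → hi ≤′ M →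
  Σ⟨ lo ⋯ hi ⟩ f ≡ Σ< M (λ n → 𝟙[ lo < n ] 𝟙[ n < hi ] f n)
Σ⟨⟩-pad lo hi f (≤′-reflexive refl) =
  Σ<-cong hi (λ n n<hi → cong 𝟙[ lo < n ]_ (sym (𝟙-holds (f n) n<hi)))
Σ⟨⟩-pad lo hi {suc M} f (≤′-step hi≤M) = begin
  Σ⟨ lo ⋯ hi ⟩ f                                       ≡⟨ Σ⟨⟩-pad lo hi f hi≤M ⟩
  Σ< M (λ n → 𝟙[ lo < n ] 𝟙[ n < hi ] f n)             ≡⟨ ℚP.+-identityʳ _ ⟨
  Σ< M (λ n → 𝟙[ lo < n ] 𝟙[ n < hi ] f n) + 0ℚ        ≡⟨ cong (λ x → Σ< M _ + x) outside ⟨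
  Σ< (suc M) (λ n → 𝟙[ lo < n ] 𝟙[ n < hi ] f n)       ∎
  where
  outside : 𝟙[ lo < M ] 𝟙[ M < hi ] f M ≡ 0ℚ
  outside = trans (cong 𝟙[ lo < M ]_ (𝟙-fails (f M) (ℕP.≤⇒≯ (ℕP.≤′⇒≤ hi≤M)))) (𝟙-0 lo M)

Σ⟨⟩-reflect : ∀ N lo hi (f : ℕ → ℚ) → hi ≤ N →
  Σ⟨ lo ⋯ hi ⟩ f ≡ Σ⟨ N ∸ hi ⋯ N ∸ lo ⟩ (λ n → f (N ∸ n))
Σ⟨⟩-reflect N lo hi f hi≤N = begin
  Σ⟨ lo ⋯ hi ⟩ f
    ≡⟨ Σ⟨⟩-pad lo hi f (ℕP.≤⇒≤′ (ℕP.m≤n⇒m≤1+n hi≤N)) ⟩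
  Σ< (suc N) (λ n → 𝟙[ lo < n ] 𝟙[ n < hi ] f n)
    ≡⟨ Σ<-reverse (suc N) _ ⟩
  Σ< (suc N) (λ j → 𝟙[ lo < N ∸ j ] 𝟙[ N ∸ j < hi ] f (N ∸ j))
    ≡⟨ Σ<-cong (suc N) (λ j j≤N → swap-window j (ℕP.≤-pred j≤N)) ⟩
  Σ< (suc N) (λ j → 𝟙[ N ∸ hi < j ] 𝟙[ j < N ∸ lo ] f (N ∸ j))
    ≡⟨ Σ⟨⟩-pad (N ∸ hi) (N ∸ lo) (λ n → f (N ∸ n)) (ℕP.≤⇒≤′ (ℕP.m≤n⇒m≤1+n (ℕP.m∸n≤m N lo))) ⟨
  Σ⟨ N ∸ hi ⋯ N ∸ lo ⟩ (λ n → f (N ∸ n))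
    ∎
  where
  swap-window : ∀ j → j ≤ N →
    𝟙[ lo < N ∸ j ] 𝟙[ N ∸ j < hi ] f (N ∸ j) ≡ 𝟙[ N ∸ hi < j ] 𝟙[ j < N ∸ lo ] f (N ∸ j)
  swap-window j j≤N = begin
    𝟙[ lo < N ∸ j ] 𝟙[ N ∸ j < hi ] f (N ∸ j)
      ≡⟨ 𝟙-comm lo (N ∸ j) (N ∸ j) hi _ ⟩
    𝟙[ N ∸ j < hi ] 𝟙[ lo < N ∸ j ] f (N ∸ j)
      ≡⟨ 𝟙-⇔ {N ∸ j} {hi} {N ∸ hi} {j} _ (mk⇔ (∸-<-swap j≤N hi≤N) (∸-<-swap hi≤N j≤N)) ⟩
    𝟙[ N ∸ hi < j ] 𝟙[ lo < N ∸ j ] f (N ∸ j)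
      ≡⟨ cong 𝟙[ N ∸ hi < j ]_ (𝟙-⇔ {lo} {N ∸ j} {j} {N ∸ lo} _ (mk⇔ <-∸-swap <-∸-swap)) ⟩
    𝟙[ N ∸ hi < j ] 𝟙[ j < N ∸ lo ] f (N ∸ j)
      ∎

infix 8 H⟨_⋯_⟩_

H⟨_⋯_⟩_ : ℕ → ℕ → List ℤ → ℚ
H⟨ lo ⋯ hi ⟩ []      = 1ℚ
H⟨ lo ⋯ hi ⟩ (a ∷ γ) = Σ⟨ lo ⋯ hi ⟩ (λ n → term a n * H⟨ n ⋯ hi ⟩ γ)

H⟨⟩-++ : ∀ γ a η lo hi →
  H⟨ lo ⋯ hi ⟩ (γ ++ a ∷ η) ≡ Σ⟨ lo ⋯ hi ⟩ (λ m → H⟨ lo ⋯ m ⟩ γ * term a m * H⟨ m ⋯ hi ⟩ η)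
H⟨⟩-++ []      a η lo hi = Σ⟨⟩-cong lo hi (λ m _ _ → sym (cong (_* H⟨ m ⋯ hi ⟩ η) (ℚP.*-identityˡ (term a m))))
H⟨⟩-++ (c ∷ γ) a η lo hi = begin
  Σ⟨ lo ⋯ hi ⟩ (λ k → term c k * H⟨ k ⋯ hi ⟩ (γ ++ a ∷ η))
    ≡⟨ Σ⟨⟩-cong lo hi (λ k _ _ → cong (term c k *_) (H⟨⟩-++ γ a η k hi)) ⟩
  Σ⟨ lo ⋯ hi ⟩ (λ k → term c k * Σ⟨ k ⋯ hi ⟩ (λ m → H⟨ k ⋯ m ⟩ γ * term a m * H⟨ m ⋯ hi ⟩ η))
    ≡⟨ Σ⟨⟩-cong lo hi (λ k _ _ → Σ⟨⟩-*ˡ k hi (term c k) _) ⟨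
  Σ⟨ lo ⋯ hi ⟩ (λ k → Σ⟨ k ⋯ hi ⟩ (λ m → term c k * (H⟨ k ⋯ m ⟩ γ * term a m * H⟨ m ⋯ hi ⟩ η)))
    ≡⟨ Σ⟨⟩-swap lo hi _ ⟩
  Σ⟨ lo ⋯ hi ⟩ (λ m → Σ⟨ lo ⋯ m ⟩ (λ k → term c k * (H⟨ k ⋯ m ⟩ γ * term a m * H⟨ m ⋯ hi ⟩ η)))
    ≡⟨ Σ⟨⟩-cong lo hi (λ m _ _ → factor-out m) ⟩
  Σ⟨ lo ⋯ hi ⟩ (λ m → H⟨ lo ⋯ m ⟩ (c ∷ γ) * term a m * H⟨ m ⋯ hi ⟩ η)
    ∎
  where
  factor-out : ∀ m → Σ⟨ lo ⋯ m ⟩ (λ k → term c k * (H⟨ k ⋯ m ⟩ γ * term a m * H⟨ m ⋯ hi ⟩ η))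
                   ≡ H⟨ lo ⋯ m ⟩ (c ∷ γ) * term a m * H⟨ m ⋯ hi ⟩ η
  factor-out m = begin
    Σ⟨ lo ⋯ m ⟩ (λ k → term c k * (H⟨ k ⋯ m ⟩ γ * term a m * H⟨ m ⋯ hi ⟩ η))
      ≡⟨ Σ⟨⟩-cong lo m (λ k _ _ → rearrange (term c k) (H⟨ k ⋯ m ⟩ γ) (term a m) (H⟨ m ⋯ hi ⟩ η)) ⟩
    Σ⟨ lo ⋯ m ⟩ (λ k → (term a m * H⟨ m ⋯ hi ⟩ η) * (term c k * H⟨ k ⋯ m ⟩ γ))
      ≡⟨ Σ⟨⟩-*ˡ lo m (term a m * H⟨ m ⋯ hi ⟩ η) _ ⟩
    (term a m * H⟨ m ⋯ hi ⟩ η) * H⟨ lo ⋯ m ⟩ (c ∷ γ)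
      ≡⟨ rotate (term a m) (H⟨ m ⋯ hi ⟩ η) (H⟨ lo ⋯ m ⟩ (c ∷ γ)) ⟩
    H⟨ lo ⋯ m ⟩ (c ∷ γ) * term a m * H⟨ m ⋯ hi ⟩ η
      ∎
    where
    rearrange : ∀ t h s u → t * (h * s * u) ≡ (s * u) * (t * h)
    rearrange = solve-∀ ℚ-ring
    rotate : ∀ s u h → (s * u) * h ≡ h * s * u
    rotate = solve-∀ ℚ-ring

H⟨⟩-∷ʳ : ∀ γ a lo hi → H⟨ lo ⋯ hi ⟩ (γ ∷ʳ a) ≡ Σ⟨ lo ⋯ hi ⟩ (λ m → H⟨ lo ⋯ m ⟩ γ * term a m)
H⟨⟩-∷ʳ γ a lo hi =
  trans (H⟨⟩-++ γ a [] lo hi) (Σ⟨⟩-cong lo hi (λ m _ _ → ℚP.*-identityʳ (H⟨ lo ⋯ m ⟩ γ * term a m)))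

hsRev≡H⟨⟩ : ∀ δ N → hsRev δ N ≡ H⟨ 0 ⋯ N ⟩ (reverse δ)
hsRev≡H⟨⟩ []      N = refl
hsRev≡H⟨⟩ (c ∷ δ) N = begin
  Σ< N (λ m → term c m * hsRev δ m)
    ≡⟨ Σ<-cong N (λ m _ → trans (cong (term c m *_) (hsRev≡H⟨⟩ δ m)) (ℚP.*-comm (term c m) _)) ⟩
  Σ< N (λ m → H⟨ 0 ⋯ m ⟩ reverse δ * term c m)
    ≡⟨ Σ⟨⟩-from-0 N _ (ℚP.*-zeroʳ (H⟨ 0 ⋯ 0 ⟩ reverse δ)) ⟨
  Σ⟨ 0 ⋯ N ⟩ (λ m → H⟨ 0 ⋯ m ⟩ reverse δ * term c m)
    ≡⟨ H⟨⟩-∷ʳ (reverse δ) c 0 N ⟨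
  H⟨ 0 ⋯ N ⟩ (reverse δ ∷ʳ c)
    ≡⟨ cong H⟨ 0 ⋯ N ⟩_ (unfold-reverse c δ) ⟨
  H⟨ 0 ⋯ N ⟩ reverse (c ∷ δ)
    ∎

H≡H⟨⟩ : ∀ γ N → H γ N ≡ H⟨ 0 ⋯ N ⟩ γ
H≡H⟨⟩ γ N = trans (hsRev≡H⟨⟩ (reverse γ) N) (cong H⟨ 0 ⋯ N ⟩_ (reverse-involutive γ))

LiCoeff-∷ʳ : ∀ γ a n → LiCoeff (γ ∷ʳ a) n ≡ term a n * H γ n
LiCoeff-∷ʳ γ a n = cong (λ l → liCoeffRev l n) (reverse-++ γ [ a ])

Σ<-LiCoeff-∷ʳ : ∀ γ a N → Σ< N (LiCoeff (γ ∷ʳ a)) ≡ H (γ ∷ʳ a) N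
Σ<-LiCoeff-∷ʳ γ a N = subst (λ l → Σ< N (liCoeffRev l) ≡ hsRev l N) (sym (reverse-++ γ [ a ])) refl

module Modulo {p : ℕ} (p-prime : Prime p) where

  Integral : ℚ → Set
  Integral x = ¬ p ∣ℕ ↧ₙ x

  Divisible : ℚ → Set
  Divisible x = + p ∣ ↥ x

  p∤1 : ¬ p ∣ℕ 1
  p∤1 p∣1 = ¬prime[1] (subst Prime (∣1⇒≡1 p∣1) p-prime)

  p∤* : ∀ {m n} → ¬ p ∣ℕ m → ¬ p ∣ℕ n → ¬ p ∣ℕ m ℕ.* n
  p∤* {m} {n} p∤m p∤n p∣mn with euclidsLemma m n p-prime p∣mn
  ... | inj₁ p∣m = p∤m p∣m
  ... | inj₂ p∣n = p∤n p∣n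

  p≢1 : p ≢ 1
  p≢1 refl = ¬prime[1] p-prime

  -- Integrality and divisibility can be read off any representation x = N / D with p ∤ D.
  p∣↥-≃ : ∀ x N e → toℚᵘ x ≃ mkℚᵘ N e → ¬ p ∣ℕ suc e → p ∣ℕ ℤ.∣ N ∣ ℕ.* ↧ₙ x → p ∣ℕ ℤ.∣ ↥ x ∣
  p∣↥-≃ (mkℚ n d _) N e (*≡* eq) p∤D p∣Nd
    with euclidsLemma ℤ.∣ n ∣ (suc e) p-prime (subst (p ∣ℕ_) cross p∣Nd)
    where
    cross : ℤ.∣ N ∣ ℕ.* suc d ≡ ℤ.∣ n ∣ ℕ.* suc e
    cross = trans (sym (ℤP.abs-* N (+ suc d))) (trans (cong ℤ.∣_∣ (sym eq)) (ℤP.abs-* n (+ suc e)))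
  ... | inj₁ p∣n = p∣n
  ... | inj₂ p∣D = contradiction p∣D p∤D

  integral-≃ : ∀ x q → toℚᵘ x ≃ q → ¬ p ∣ℕ ℚᵘ.↧ₙ q → Integral x
  integral-≃ x@(mkℚ n d c) (mkℚᵘ N e) x≃q p∤D p∣d =
    p≢1 (recompute (coprime? ℤ.∣ n ∣ (suc d)) c (p∣↥-≃ x N e x≃q p∤D (ℕ∣.∣n⇒∣m*n ℤ.∣ N ∣ p∣d) , p∣d))

  divisible-≃ : ∀ x q → toℚᵘ x ≃ q → ¬ p ∣ℕ ℚᵘ.↧ₙ q → + p ∣ ℚᵘ.↥ q → Divisible x
  divisible-≃ x (mkℚᵘ N e) x≃q p∤D p∣N =
    ℤ∣.∣ᵤ⇒∣ (p∣↥-≃ x N e x≃q p∤D (ℕ∣.∣m⇒∣m*n (↧ₙ x) (ℤ∣.∣⇒∣ᵤ p∣N)))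

  integral-1 : Integral 1ℚ
  integral-1 = p∤1

  integral-0 : Integral 0ℚ
  integral-0 = p∤1

  integral-+ : ∀ x y → Integral x → Integral y → Integral (x + y)
  integral-+ x@record{} y@record{} x∈ y∈ = integral-≃ (x + y) _ (ℚP.toℚᵘ-homo-+ x y) (p∤* x∈ y∈)

  integral-* : ∀ x y → Integral x → Integral y → Integral (x * y)
  integral-* x@record{} y@record{} x∈ y∈ = integral-≃ (x * y) _ (ℚP.toℚᵘ-homo-* x y) (p∤* x∈ y∈)

  integral-neg : ∀ x → Integral x → Integral (- x)
  integral-neg x@record{} x∈ = integral-≃ (- x) _ (ℚP.toℚᵘ-homo‿- x) x∈

  integral-^ : ∀ x n → Integral x → Integral (x ^ℚ n)
  integral-^ x zero    x∈ = integral-1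
  integral-^ x (suc n) x∈ = integral-* x (x ^ℚ n) x∈ (integral-^ x n x∈)

  integral-sgn : ∀ a → Integral (sgn a)
  integral-sgn (+ _)    = p∤1
  integral-sgn -[1+ _ ] = p∤1

  divisible-0 : Divisible 0ℚ
  divisible-0 = ℤ∣.∣ᵤ⇒∣ (p ℕ∣.∣0)

  divisible-+ : ∀ x y → Integral x → Integral y → Divisible x → Divisible y → Divisible (x + y)
  divisible-+ x@record{} y@record{} x∈ y∈ p∣m p∣n =
    divisible-≃ (x + y) _ (ℚP.toℚᵘ-homo-+ x y) (p∤* x∈ y∈)
      (ℤ∣.∣m∣n⇒∣m+n (ℤ∣.∣m⇒∣m*n _ p∣m) (ℤ∣.∣m⇒∣m*n _ p∣n))

  divisible-*ˡ : ∀ x y → Integral x → Integral y → Divisible x → Divisible (x * y)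
  divisible-*ˡ x@record{} y@record{} x∈ y∈ p∣m =
    divisible-≃ (x * y) _ (ℚP.toℚᵘ-homo-* x y) (p∤* x∈ y∈) (ℤ∣.∣m⇒∣m*n _ p∣m)

  divisible-*ʳ : ∀ x y → Integral x → Integral y → Divisible y → Divisible (x * y)
  divisible-*ʳ x@record{} y@record{} x∈ y∈ p∣n =
    divisible-≃ (x * y) _ (ℚP.toℚᵘ-homo-* x y) (p∤* x∈ y∈) (ℤ∣.∣n⇒∣m*n (↥ x) p∣n)

  infix 4 _≈_

  record _≈_ (x y : ℚ) : Set where
    field
      integralˡ  : Integral x
      integralʳ  : Integral y
      difference : Divisible (x - y)

  open _≈_ public

  ≈⇒≡[modℚ] : ∀ {x y} → x ≈ y → x ≡ y [modℚ p ]
  ≈⇒≡[modℚ] x≈y = ℤ∣.∣⇒∣ᵤ (difference x≈y)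

  integral-difference : ∀ {x y} → x ≈ y → Integral (x - y)
  integral-difference {x} {y} x≈y = integral-+ x (- y) (integralˡ x≈y) (integral-neg y (integralʳ x≈y))

  ≈-refl : ∀ {x} → Integral x → x ≈ x
  ≈-refl {x} x∈ = record
    { integralˡ  = x∈
    ; integralʳ  = x∈
    ; difference = subst Divisible (sym (ℚP.+-inverseʳ x)) divisible-0
    }

  ≈-+ : ∀ {x x′ y y′} → x ≈ y → x′ ≈ y′ → x + x′ ≈ y + y′
  ≈-+ {x} {x′} {y} {y′} x≈y x′≈y′ = record
    { integralˡ  = integral-+ x x′ (integralˡ x≈y) (integralˡ x′≈y′)
    ; integralʳ  = integral-+ y y′ (integralʳ x≈y) (integralʳ x′≈y′)
    ; difference = subst Divisible (sym (regroup x x′ y y′))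
        (divisible-+ (x - y) (x′ - y′) (integral-difference x≈y) (integral-difference x′≈y′)
                     (difference x≈y) (difference x′≈y′))
    }
    where
    regroup : ∀ a a′ b b′ → (a + a′) - (b + b′) ≡ (a - b) + (a′ - b′)
    regroup = solve-∀ ℚ-ring

  ≈-* : ∀ {x x′ y y′} → x ≈ y → x′ ≈ y′ → x * x′ ≈ y * y′
  ≈-* {x} {x′} {y} {y′} x≈y x′≈y′ = record
    { integralˡ  = integral-* x x′ (integralˡ x≈y) (integralˡ x′≈y′)
    ; integralʳ  = integral-* y y′ (integralʳ x≈y) (integralʳ x′≈y′)
    ; difference = subst Divisible (sym (regroup x x′ y y′))
        (divisible-+ ((x - y) * x′) (y * (x′ - y′))
          (integral-* (x - y) x′ (integral-difference x≈y) (integralˡ x′≈y′))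
          (integral-* y (x′ - y′) (integralʳ x≈y) (integral-difference x′≈y′))
          (divisible-*ˡ (x - y) x′ (integral-difference x≈y) (integralˡ x′≈y′) (difference x≈y))
          (divisible-*ʳ y (x′ - y′) (integralʳ x≈y) (integral-difference x′≈y′) (difference x′≈y′)))
    }
    where
    regroup : ∀ a a′ b b′ → a * a′ - b * b′ ≡ (a - b) * a′ + b * (a′ - b′)
    regroup = solve-∀ ℚ-ring

  Σ<-≈ : ∀ N {f g : ℕ → ℚ} → (∀ k → k < N → f k ≈ g k) → Σ< N f ≈ Σ< N g
  Σ<-≈ zero    f≈g = ≈-refl integral-0
  Σ<-≈ (suc N) f≈g = ≈-+ (Σ<-≈ N (λ k k<N → f≈g k (ℕP.m<n⇒m<1+n k<N))) (f≈g N (ℕP.n<1+n N))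

  Σ⟨⟩-≈ : ∀ lo hi {f g : ℕ → ℚ} → (∀ n → lo < n → n < hi → f n ≈ g n) →
    Σ⟨ lo ⋯ hi ⟩ f ≈ Σ⟨ lo ⋯ hi ⟩ g
  Σ⟨⟩-≈ lo hi {f} {g} f≈g = Σ<-≈ hi pointwise
    where
    pointwise : ∀ n → n < hi → 𝟙[ lo < n ] f n ≈ 𝟙[ lo < n ] g n
    pointwise n n<hi with lo <? n
    ... | yes lo<n = f≈g n lo<n n<hi
    ... | no  _    = ≈-refl integral-0

  integral-Σ⟨⟩ : ∀ lo hi (f : ℕ → ℚ) → (∀ n → lo < n → n < hi → Integral (f n)) → Integral (Σ⟨ lo ⋯ hi ⟩ f)
  integral-Σ⟨⟩ lo hi f f∈ = integralˡ (Σ⟨⟩-≈ lo hi (λ n lo<n n<hi → ≈-refl (f∈ n lo<n n<hi)))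

[m-n]∣[m^k-n^k] : ∀ m n k → (m ℤ.- n) ∣ (m ℤ.^ k ℤ.- n ℤ.^ k)
[m-n]∣[m^k-n^k] m n zero    = ℤ∣.∣ᵤ⇒∣ (_ ℕ∣.∣0)
[m-n]∣[m^k-n^k] m n (suc k) = subst ((m ℤ.- n) ∣_) (sym (expand m n (m ℤ.^ k) (n ℤ.^ k)))
  (ℤ∣.∣m∣n⇒∣m+n (ℤ∣.∣n⇒∣m*n m ([m-n]∣[m^k-n^k] m n k)) (ℤ∣.∣m⇒∣m*n (n ℤ.^ k) ℤ∣.∣-refl))
  where
  expand : ∀ m n mᵏ nᵏ → m ℤ.* mᵏ ℤ.- n ℤ.* nᵏ ≡ m ℤ.* (mᵏ ℤ.- nᵏ) ℤ.+ (m ℤ.- n) ℤ.* nᵏ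
  expand = ℤ-Solver.solve-∀

toℚᵘ-/ : ∀ i n .{{_ : ℕ.NonZero n}} → toℚᵘ (i ℚ./ n) ≃ mkℚᵘ i (ℕ.pred n)
toℚᵘ-/ i n = ℚᵘP.≃-trans (ℚP.toℚᵘ-cong (ℚP./-cong {i} refl (sym (ℕP.suc-pred n))))
                          (ℚP.toℚᵘ-fromℚᵘ (mkℚᵘ i (ℕ.pred n)))

toℚᵘ-[-1]^ : ∀ k → toℚᵘ ((- 1ℚ) ^ℚ k) ≃ mkℚᵘ (-1ℤ ℤ.^ k) 0
toℚᵘ-[-1]^ zero    = ℚᵘP.≃-refl
toℚᵘ-[-1]^ (suc k) = ℚᵘP.≃-trans (ℚP.toℚᵘ-homo-* (- 1ℚ) ((- 1ℚ) ^ℚ k))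
                                 (ℚᵘP.*-cong (ℚᵘP.≃-refl {toℚᵘ (- 1ℚ)}) (toℚᵘ-[-1]^ k))

inv-pow : ℕ → ℕ → ℚ
inv-pow m k = ℚ._/_ (+ 1) (suc m ℕ.^ k) {{ℕP.m^n≢0 (suc m) k}}

pos-^ : ∀ m k → + (m ℕ.^ k) ≡ (+ m) ℤ.^ k
pos-^ m zero    = refl
pos-^ m (suc k) = trans (ℤP.pos-* m (m ℕ.^ k)) (cong ((+ m) ℤ.*_) (pos-^ m k))

^-distribʳ-* : ∀ k m n → (m ℤ.* n) ℤ.^ k ≡ m ℤ.^ k ℤ.* n ℤ.^ k
^-distribʳ-* zero    m n = refl
^-distribʳ-* (suc k) m n = trans (cong ((m ℤ.* n) ℤ.*_) (^-distribʳ-* k m n)) (interchange m n (m ℤ.^ k) (n ℤ.^ k))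
  where
  interchange : ∀ a b c d → (a ℤ.* b) ℤ.* (c ℤ.* d) ≡ (a ℤ.* c) ℤ.* (b ℤ.* d)
  interchange = ℤ-Solver.solve-∀

even-or-odd : ∀ n → Σ ℕ (λ m → n ≡ m ℕ.+ m) ⊎ Σ ℕ (λ m → n ≡ suc (m ℕ.+ m))
even-or-odd zero    = inj₁ (0 , refl)
even-or-odd (suc n) with even-or-odd n
... | inj₁ (m , n≡m+m)   = inj₂ (m , cong suc n≡m+m)
... | inj₂ (m , n≡1+m+m) = inj₁ (suc m , cong suc (trans n≡1+m+m (sym (ℕP.+-suc m m))))

odd-prime : ∀ {p} → Prime p → 2 < p → Σ ℕ (λ m → p ≡ suc (m ℕ.+ m))
odd-prime {p} p-prime 2<p with even-or-odd p
... | inj₂ p-odd        = p-odd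
... | inj₁ (m , p≡m+m) with prime⇒irreducible p-prime (divides m (trans p≡m+m m+m≡m*2))
  where
  m+m≡m*2 : m ℕ.+ m ≡ m ℕ.* 2
  m+m≡m*2 = trans (cong (m ℕ.+_) (sym (ℕP.+-identityʳ m))) (ℕP.*-comm 2 m)
...   | inj₁ ()
...   | inj₂ 2≡p = contradiction (subst (2 <_) (sym 2≡p) 2<p) (ℕP.<-irrefl refl)

^ℚ-+ : ∀ q m n → q ^ℚ (m ℕ.+ n) ≡ q ^ℚ m * q ^ℚ n
^ℚ-+ q zero    n = sym (ℚP.*-identityˡ (q ^ℚ n))
^ℚ-+ q (suc m) n = trans (cong (q *_) (^ℚ-+ q m n)) (sym (ℚP.*-assoc q (q ^ℚ m) (q ^ℚ n)))

^ℚ-even : ∀ q → q * q ≡ 1ℚ → ∀ m → q ^ℚ (m ℕ.+ m) ≡ 1ℚ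
^ℚ-even q q²≡1 zero    = refl
^ℚ-even q q²≡1 (suc m) = begin
  q * q ^ℚ (m ℕ.+ suc m)    ≡⟨ cong (λ n → q * q ^ℚ n) (ℕP.+-suc m m) ⟩
  q * (q * q ^ℚ (m ℕ.+ m))  ≡⟨ ℚP.*-assoc q q _ ⟨
  (q * q) * q ^ℚ (m ℕ.+ m)  ≡⟨ cong₂ _*_ q²≡1 (^ℚ-even q q²≡1 m) ⟩
  1ℚ                        ∎

^ℚ-odd : ∀ q → q * q ≡ 1ℚ → ∀ {x y m} → x ℕ.+ y ≡ suc (m ℕ.+ m) → q ^ℚ x ≡ q * q ^ℚ y
^ℚ-odd q q²≡1 {x} {y} {m} x+y≡2m+1 = begin
  q ^ℚ x                           ≡⟨ ℚP.*-identityʳ (q ^ℚ x) ⟨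
  q ^ℚ x * 1ℚ                      ≡⟨ cong (q ^ℚ x *_) (trans (sym (^ℚ-+ q y y)) (^ℚ-even q q²≡1 y)) ⟨
  q ^ℚ x * (q ^ℚ y * q ^ℚ y)       ≡⟨ ℚP.*-assoc (q ^ℚ x) _ _ ⟨
  (q ^ℚ x * q ^ℚ y) * q ^ℚ y       ≡⟨ cong (_* q ^ℚ y) (trans (sym (^ℚ-+ q x y)) (cong (q ^ℚ_) x+y≡2m+1)) ⟩
  (q * q ^ℚ (m ℕ.+ m)) * q ^ℚ y    ≡⟨ cong (λ r → (q * r) * q ^ℚ y) (^ℚ-even q q²≡1 m) ⟩
  (q * 1ℚ) * q ^ℚ y                ≡⟨ cong (_* q ^ℚ y) (ℚP.*-identityʳ q) ⟩
  q * q ^ℚ y                       ∎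

sgn²≡1 : ∀ a → sgn a * sgn a ≡ 1ℚ
sgn²≡1 (+ _)    = refl
sgn²≡1 -[1+ _ ] = refl

-- the factor sgn(a) (−1)^|a| picked up by term a under n ↦ p − n
ε : ℤ → ℚ
ε a = sgn a * (- 1ℚ) ^ℚ ℤ.∣ a ∣

ε-list : List ℤ → ℚ
ε-list β = sgnList β * (- 1ℚ) ^ℚ wt β

ε-list-∷ : ∀ b β → ε-list (b ∷ β) ≡ ε b * ε-list β
ε-list-∷ b β = trans (cong (sgnList (b ∷ β) *_) (^ℚ-+ (- 1ℚ) ℤ.∣ b ∣ (wt β)))
                     (interchange (sgn b) (sgnList β) _ _)
  where
  interchange : ∀ s t u v → (s * t) * (u * v) ≡ (s * u) * (t * v)
  interchange = solve-∀ ℚ-ring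

module Reflection {p : ℕ} (p-prime : Prime p) (2<p : 2 < p) where
  open Modulo p-prime

  p∤^ : ∀ m k → suc m < p → ¬ p ∣ℕ suc m ℕ.^ k
  p∤^ m zero    _   = p∤1
  p∤^ m (suc k) m<p = p∤* (λ p∣m → contradiction (ℕ∣.∣⇒≤ p∣m) (ℕP.<⇒≱ m<p)) (p∤^ m k m<p)

  integral-inv-pow : ∀ m k → suc m < p → Integral (inv-pow m k)
  integral-inv-pow m k m<p =
    integral-≃ (inv-pow m k) _ (toℚᵘ-/ (+ 1) X) (subst (λ n → ¬ p ∣ℕ n) (sym (ℕP.suc-pred X)) (p∤^ m k m<p))
    where
    X = suc m ℕ.^ k
    instance _ = ℕP.m^n≢0 (suc m) k

  -- Over a denominator prime to p, the difference has numerator j^k − (−i)^k, a multiple of j − (−i) = p.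
  inv-pow-reflect : ∀ i j k → suc i ℕ.+ suc j ≡ p → inv-pow i k ≈ (- 1ℚ) ^ℚ k * inv-pow j k
  inv-pow-reflect i j k i+j≡p = record
    { integralˡ  = integral-inv-pow i k i<p
    ; integralʳ  = integral-* σ (inv-pow j k) (integral-^ (- 1ℚ) k p∤1) (integral-inv-pow j k j<p)
    ; difference = divisible-≃ _ q toℚᵘ-difference p∤denominator p∣numerator
    }
    where
    X = suc i ℕ.^ k
    Y = suc j ℕ.^ k
    instance
      _ = ℕP.m^n≢0 (suc i) k
      _ = ℕP.m^n≢0 (suc j) k
    σ = (- 1ℚ) ^ℚ k
    σ′ = -1ℤ ℤ.^ k
    i<p : suc i < p
    i<p = subst (suc i <_) i+j≡p (ℕP.m<m+n (suc i) ℕ.z<s)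
    j<p : suc j < p
    j<p = subst (suc j <_) i+j≡p (ℕP.m<n+m (suc j) ℕ.z<s)
    q : ℚᵘ
    q = mkℚᵘ (+ 1) (ℕ.pred X) ℚᵘ.- mkℚᵘ σ′ 0 ℚᵘ.* mkℚᵘ (+ 1) (ℕ.pred Y)
    toℚᵘ-difference : toℚᵘ (inv-pow i k - σ * inv-pow j k) ≃ q
    toℚᵘ-difference =
      ℚᵘP.≃-trans (ℚP.toℚᵘ-homo-+ (inv-pow i k) (- (σ * inv-pow j k)))
        (ℚᵘP.+-cong (toℚᵘ-/ (+ 1) X)
          (ℚᵘP.≃-trans (ℚP.toℚᵘ-homo‿- (σ * inv-pow j k))
            (ℚᵘP.-‿cong (ℚᵘP.≃-trans (ℚP.toℚᵘ-homo-* σ (inv-pow j k))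
                                     (ℚᵘP.*-cong (toℚᵘ-[-1]^ k) (toℚᵘ-/ (+ 1) Y))))))
    p∤denominator : ¬ p ∣ℕ ℚᵘ.↧ₙ q
    p∤denominator = p∤* (subst (λ n → ¬ p ∣ℕ n) (sym (ℕP.suc-pred X)) (p∤^ i k i<p))
                        (subst (λ n → ¬ p ∣ℕ n) (sym (trans (ℕP.*-identityˡ _) (ℕP.suc-pred Y))) (p∤^ j k j<p))
    numerator : ℚᵘ.↥ q ≡ (+ suc j) ℤ.^ k ℤ.- (ℤ.- (+ suc i)) ℤ.^ k
    numerator = begin
      (+ 1) ℤ.* (+ (1 ℕ.* suc (ℕ.pred Y))) ℤ.+ (ℤ.- (σ′ ℤ.* + 1)) ℤ.* (+ suc (ℕ.pred X))
        ≡⟨ cong₂ (λ y x → (+ 1) ℤ.* y ℤ.+ (ℤ.- (σ′ ℤ.* + 1)) ℤ.* x)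
                 (trans (cong (λ n → + n) (trans (ℕP.*-identityˡ _) (ℕP.suc-pred Y))) (pos-^ (suc j) k))
                 (trans (cong (λ n → + n) (ℕP.suc-pred X)) (pos-^ (suc i) k)) ⟩
      (+ 1) ℤ.* (+ suc j) ℤ.^ k ℤ.+ (ℤ.- (σ′ ℤ.* + 1)) ℤ.* (+ suc i) ℤ.^ k
        ≡⟨ simplify ((+ suc j) ℤ.^ k) ((+ suc i) ℤ.^ k) σ′ ⟩
      (+ suc j) ℤ.^ k ℤ.- σ′ ℤ.* (+ suc i) ℤ.^ k
        ≡⟨ cong (λ m → (+ suc j) ℤ.^ k ℤ.- m) (sym (^-distribʳ-* k -1ℤ (+ suc i))) ⟩
      (+ suc j) ℤ.^ k ℤ.- (-1ℤ ℤ.* + suc i) ℤ.^ k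
        ≡⟨ cong (λ m → (+ suc j) ℤ.^ k ℤ.- m ℤ.^ k) (ℤP.-1*i≡-i (+ suc i)) ⟩
      (+ suc j) ℤ.^ k ℤ.- (ℤ.- (+ suc i)) ℤ.^ k
        ∎
      where
      simplify : ∀ y x s → (+ 1) ℤ.* y ℤ.+ (ℤ.- (s ℤ.* + 1)) ℤ.* x ≡ y ℤ.- s ℤ.* x
      simplify = ℤ-Solver.solve-∀
    j+i≡p : + p ≡ (+ suc j) ℤ.- (ℤ.- (+ suc i))
    j+i≡p = begin
      + p                               ≡⟨ cong +_ (trans (sym i+j≡p) (ℕP.+-comm (suc i) (suc j))) ⟩
      + (suc j ℕ.+ suc i)               ≡⟨ ℤP.pos-+ (suc j) (suc i) ⟩
      (+ suc j) ℤ.+ (+ suc i)           ≡⟨ cong (λ m → (+ suc j) ℤ.+ m) (ℤP.neg-involutive (+ suc i)) ⟨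
      (+ suc j) ℤ.- (ℤ.- (+ suc i))     ∎
    p∣numerator : + p ∣ ℚᵘ.↥ q
    p∣numerator = subst (+ p ∣_) (sym numerator)
      (ℤ∣.∣-trans (ℤ∣.∣-reflexive j+i≡p) ([m-n]∣[m^k-n^k] (+ suc j) (ℤ.- (+ suc i)) k))

  integral-term : ∀ a n → n < p → Integral (term a n)
  integral-term a zero    _   = integral-0
  integral-term a (suc m) m<p =
    integral-* (sgn a ^ℚ suc m) (inv-pow m ℤ.∣ a ∣)
      (integral-^ (sgn a) (suc m) (integral-sgn a)) (integral-inv-pow m ℤ.∣ a ∣ m<p)

  term-reflect : ∀ a m → 0 < m → m < p → term a (p ∸ m) ≈ ε a * term a m
  term-reflect a (suc j) _ m<p = subst (λ n → term a n ≈ ε a * term a (suc j)) (sym p∸m≡1+i)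
    (subst₂ _≈_ (cong (_* inv-pow i k) (sym sign)) (regroup s (s ^ℚ suc j) ((- 1ℚ) ^ℚ k) (inv-pow j k))
      (≈-* (≈-refl {s * s ^ℚ suc j} (integral-* s (s ^ℚ suc j) (integral-sgn a) (integral-^ s (suc j) (integral-sgn a))))
           (inv-pow-reflect i j k i+j≡p)))
    where
    s = sgn a
    k = ℤ.∣ a ∣
    i = p ∸ suc (suc j)
    p∸m≡1+i : p ∸ suc j ≡ suc i
    p∸m≡1+i = ℕP.+-∸-assoc 1 m<p
    i+j≡p : suc i ℕ.+ suc j ≡ p
    i+j≡p = trans (cong (ℕ._+ suc j) (sym p∸m≡1+i)) (ℕP.m∸n+n≡m (ℕP.<⇒≤ m<p))
    sign : s ^ℚ suc i ≡ s * s ^ℚ suc j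
    sign with m , p≡2m+1 ← odd-prime p-prime 2<p = ^ℚ-odd s (sgn²≡1 a) {suc i} {suc j} {m} (trans i+j≡p p≡2m+1)
    regroup : ∀ s t σ v → (s * t) * (σ * v) ≡ (s * σ) * (t * v)
    regroup = solve-∀ ℚ-ring

  integral-H⟨⟩ : ∀ γ lo hi → hi ≤ p → Integral (H⟨ lo ⋯ hi ⟩ γ)
  integral-H⟨⟩ []      lo hi _    = integral-1
  integral-H⟨⟩ (c ∷ γ) lo hi hi≤p = integral-Σ⟨⟩ lo hi _ λ n _ n<hi →
    integral-* (term c n) (H⟨ n ⋯ hi ⟩ γ) (integral-term c n (ℕP.<-≤-trans n<hi hi≤p)) (integral-H⟨⟩ γ n hi hi≤p)

  H⟨⟩-reflect : ∀ β lo hi → hi ≤ p → H⟨ lo ⋯ hi ⟩ β ≈ ε-list β * H⟨ p ∸ hi ⋯ p ∸ lo ⟩ reverse β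
  H⟨⟩-reflect []      lo hi _    = ≈-refl integral-1
  H⟨⟩-reflect (b ∷ β) lo hi hi≤p =
    subst₂ _≈_ (sym (Σ⟨⟩-reflect p lo hi _ hi≤p)) collect (Σ⟨⟩-≈ (p ∸ hi) (p ∸ lo) reflect-summand)
    where
    reflect-summand : ∀ n → p ∸ hi < n → n < p ∸ lo →
      term b (p ∸ n) * H⟨ p ∸ n ⋯ hi ⟩ β ≈ (ε b * term b n) * (ε-list β * H⟨ p ∸ hi ⋯ n ⟩ reverse β)
    reflect-summand n p∸hi<n n<p∸lo = ≈-* (term-reflect b n (ℕP.<-≤-trans (s≤s z≤n) p∸hi<n) n<p)
      (subst (λ m → H⟨ p ∸ n ⋯ hi ⟩ β ≈ ε-list β * H⟨ p ∸ hi ⋯ m ⟩ reverse β)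
             (ℕP.m∸[m∸n]≡n (ℕP.<⇒≤ n<p)) (H⟨⟩-reflect β (p ∸ n) hi hi≤p))
      where
      n<p : n < p
      n<p = ℕP.<-≤-trans n<p∸lo (ℕP.m∸n≤m p lo)
    collect : Σ⟨ p ∸ hi ⋯ p ∸ lo ⟩ (λ n → (ε b * term b n) * (ε-list β * H⟨ p ∸ hi ⋯ n ⟩ reverse β))
            ≡ ε-list (b ∷ β) * H⟨ p ∸ hi ⋯ p ∸ lo ⟩ reverse (b ∷ β)
    collect = begin
      Σ⟨ p ∸ hi ⋯ p ∸ lo ⟩ (λ n → (ε b * term b n) * (ε-list β * H⟨ p ∸ hi ⋯ n ⟩ reverse β))
        ≡⟨ Σ⟨⟩-cong (p ∸ hi) (p ∸ lo) (λ n _ _ → regroup (ε b) (term b n) (ε-list β) _) ⟩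
      Σ⟨ p ∸ hi ⋯ p ∸ lo ⟩ (λ n → (ε b * ε-list β) * (H⟨ p ∸ hi ⋯ n ⟩ reverse β * term b n))
        ≡⟨ Σ⟨⟩-*ˡ (p ∸ hi) (p ∸ lo) (ε b * ε-list β) _ ⟩
      (ε b * ε-list β) * Σ⟨ p ∸ hi ⋯ p ∸ lo ⟩ (λ n → H⟨ p ∸ hi ⋯ n ⟩ reverse β * term b n)
        ≡⟨ cong₂ _*_ (ε-list-∷ b β) (H⟨⟩-∷ʳ (reverse β) b (p ∸ hi) (p ∸ lo)) ⟨
      ε-list (b ∷ β) * H⟨ p ∸ hi ⋯ p ∸ lo ⟩ (reverse β ∷ʳ b)
        ≡⟨ cong (λ γ → ε-list (b ∷ β) * H⟨ p ∸ hi ⋯ p ∸ lo ⟩ γ) (unfold-reverse b β) ⟨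
      ε-list (b ∷ β) * H⟨ p ∸ hi ⋯ p ∸ lo ⟩ reverse (b ∷ β)
        ∎
      where
      regroup : ∀ e t f h → (e * t) * (f * h) ≡ (e * f) * (h * t)
      regroup = solve-∀ ℚ-ring

  Li-product-reflect : ∀ αs a βs b → let α = αs ∷ʳ a ; β = βs ∷ʳ b in
    𝔏 p (prodCoeff (LiCoeff α) (LiCoeff β)) ≈ ε-list β * H (α ++ reverse β) p
  Li-product-reflect αs a βs b = subst₂ _≈_ (sym expand-lhs) (sym expand-rhs) (Σ<-≈ p reflect-tail)
    where
    α = αs ∷ʳ a
    β = βs ∷ʳ b
    head : ℕ → ℚ
    head k = term a k * H⟨ 0 ⋯ k ⟩ αs
    expand-lhs : 𝔏 p (prodCoeff (LiCoeff α) (LiCoeff β)) ≡ Σ< p (λ k → head k * H⟨ 0 ⋯ p ∸ k ⟩ β)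
    expand-lhs = trans (Σ<-convolution p (LiCoeff α) (LiCoeff β)) (Σ<-cong p λ k _ →
      cong₂ _*_ (trans (LiCoeff-∷ʳ αs a k) (cong (term a k *_) (H≡H⟨⟩ αs k)))
                (trans (Σ<-LiCoeff-∷ʳ βs b (p ∸ k)) (H≡H⟨⟩ β (p ∸ k))))
    reflect-tail : ∀ k → k < p → head k * H⟨ 0 ⋯ p ∸ k ⟩ β ≈ head k * (ε-list β * H⟨ k ⋯ p ⟩ reverse β)
    reflect-tail k k<p = ≈-* (≈-refl {head k} head∈)
      (subst (λ m → H⟨ 0 ⋯ p ∸ k ⟩ β ≈ ε-list β * H⟨ m ⋯ p ⟩ reverse β)
             (ℕP.m∸[m∸n]≡n (ℕP.<⇒≤ k<p)) (H⟨⟩-reflect β 0 (p ∸ k) (ℕP.m∸n≤m p k)))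
      where
      head∈ : Integral (head k)
      head∈ = integral-* (term a k) (H⟨ 0 ⋯ k ⟩ αs) (integral-term a k k<p) (integral-H⟨⟩ αs 0 k (ℕP.<⇒≤ k<p))
    expand-rhs : ε-list β * H (α ++ reverse β) p ≡ Σ< p (λ k → head k * (ε-list β * H⟨ k ⋯ p ⟩ reverse β))
    expand-rhs = begin
      ε-list β * H (α ++ reverse β) p
        ≡⟨ cong (ε-list β *_) (H≡H⟨⟩ (α ++ reverse β) p) ⟩
      ε-list β * H⟨ 0 ⋯ p ⟩ (α ++ reverse β)
        ≡⟨ cong (λ γ → ε-list β * H⟨ 0 ⋯ p ⟩ γ) (∷ʳ-++ αs a (reverse β)) ⟩
      ε-list β * H⟨ 0 ⋯ p ⟩ (αs ++ a ∷ reverse β)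
        ≡⟨ cong (ε-list β *_) (H⟨⟩-++ αs a (reverse β) 0 p) ⟩
      ε-list β * Σ⟨ 0 ⋯ p ⟩ (λ k → H⟨ 0 ⋯ k ⟩ αs * term a k * H⟨ k ⋯ p ⟩ reverse β)
        ≡⟨ cong (ε-list β *_) (Σ⟨⟩-from-0 p _ vanishes-at-0) ⟩
      ε-list β * Σ< p (λ k → H⟨ 0 ⋯ k ⟩ αs * term a k * H⟨ k ⋯ p ⟩ reverse β)
        ≡⟨ Σ<-*ˡ p (ε-list β) _ ⟨
      Σ< p (λ k → ε-list β * (H⟨ 0 ⋯ k ⟩ αs * term a k * H⟨ k ⋯ p ⟩ reverse β))
        ≡⟨ Σ<-cong p (λ k _ → regroup (ε-list β) (H⟨ 0 ⋯ k ⟩ αs) (term a k) _) ⟩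
      Σ< p (λ k → head k * (ε-list β * H⟨ k ⋯ p ⟩ reverse β))
        ∎
      where
      vanishes-at-0 : H⟨ 0 ⋯ 0 ⟩ αs * term a 0 * H⟨ 0 ⋯ p ⟩ reverse β ≡ 0ℚ
      vanishes-at-0 = trans (cong (_* H⟨ 0 ⋯ p ⟩ reverse β) (ℚP.*-zeroʳ (H⟨ 0 ⋯ 0 ⟩ αs)))
                     (ℚP.*-zeroˡ (H⟨ 0 ⋯ p ⟩ reverse β))
      regroup : ∀ e h t r → e * (h * t * r) ≡ (t * h) * (e * r)
      regroup = solve-∀ ℚ-ring

Li-product-≡𝒜 : ∀ (α β : List ℤ) → α ≢ [] → β ≢ [] →
  (λ p → 𝔏 p (prodCoeff (LiCoeff α) (LiCoeff β))) ≡𝒜 (λ p → ε-list β * H (α ++ reverse β) p)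
Li-product-≡𝒜 α β α≢[] β≢[] with initLast α | initLast β
... | []       | _        = contradiction refl α≢[]
... | _        | []       = contradiction refl β≢[]
... | αs ∷ʳ′ a | βs ∷ʳ′ b = 2 , λ p p-prime 2<p →
  Modulo.≈⇒≡[modℚ] p-prime (Reflection.Li-product-reflect p-prime 2<p αs a βs b)

lemma2p2 : (s t : ℕ) → 1 ≤ s → 1 ≤ t →
    (α : Vec ℤ s) → (β : Vec ℤ t) →
    All (λ a → a ≢ 0ℤ) α → All (λ b → b ≢ 0ℤ) β →
    (λ p → 𝔏 p (prodCoeff (LiCoeff (toList α)) (LiCoeff (toList β))))
      ≡𝒜
    (λ p → (sgnList (toList β) * ((- 1ℚ) ^ℚ wt (toList β))) * H (toList α ++ reverse (toList β)) p)
-- The indices need not be nonzero: the argument works for every a ∈ ℤ.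
lemma2p2 (suc s) (suc t) _ _ (a ∷ α) (b ∷ β) _ _ = Li-product-≡𝒜 (toList (a ∷ α)) (toList (b ∷ β)) (λ ()) (λ ())
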